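{- For a reduced integer $n=2^{a_1}3^{a_2}\cdots p_k^{a_k}$ (so $a_i=0$ for $i>k$), $$\sum_{i:\,a_i\ge3}(a_i-2)=O\!\left(\frac{k^{2/3}}{(\log k)^{1/3}}\right),$$ with an absolute implied constant (as $k\to\infty$).
   Context: Let $p_i$ denote the $i$-th prime ($p_1=2$). A positive integer $2^{a_1}3^{a_2}5^{a_3}\cdots=\prod_i p_i^{a_i}$ (with $a_i=0$ for all sufficiently large $i$) is called reduced if $\left\lfloor\frac{a_i+1}{a_j+2}\right\rfloor<\frac{\log p_j}{\log p_i}$ whenever $i,j\ne1$, and $2^{a_1}<8p_j^2$ whenever $a_j=0$. -}

module Defs where

open import Data.Nat using (ℕ; zero; suc; _+_; _*_; _∸_; _^_; _≤_; _<_; _≥_; _/_; _≤ᵇ_)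
open import Data.Nat.Primality using (Prime)
open import Data.Bool using (if_then_else_)
open import Data.List using (map; upTo)
open import Data.Nat.ListAction using (sum)
open import Data.Product using (∃; _×_)
open import Relation.Binary.PropositionalEquality using (_≡_; _≢_)

-- Exponent vectors are 0-indexed: a i is the exponent of the (i+1)-th prime,
-- so the paper's a_1 (exponent of 2) is a 0.

record PrimeEnumeration (p : ℕ → ℕ) : Set where
  field
    isPrime    : ∀ i → Prime (p i)
    increasing : ∀ i → p i < p (suc i)
    onto       : ∀ q → Prime q → ∃ λ i → p i ≡ q

-- Condition 1 (paper indices i,j ≠ 1, i.e. here i,j ≠ 0):
--   ⌊(a_i+1)/(a_j+2)⌋ < log p_j / log p_i,
-- equivalently (as p_i > 1 and the floor is a natural number)
--   p_i ^ ⌊(a_i+1)/(a_j+2)⌋ < p_j.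
Reduced : (p : ℕ → ℕ) → (a : ℕ → ℕ) → Set
Reduced p a =
  (∀ i j → i ≢ 0 → j ≢ 0 → p i ^ ((a i + 1) / (2 + a j)) < p j)
  × (∀ j → a j ≡ 0 → 2 ^ a 0 < 8 * p j ^ 2)

excess : ℕ → ℕ
excess x = if 3 ≤ᵇ x then x ∸ 2 else 0

excessSum : (a : ℕ → ℕ) → (k : ℕ) → ℕ
excessSum a k = sum (map (λ i → excess (a i)) (upTo k))

module Submission where

-- Since a k = 0, reducedness tested against the prime p k gives
-- p i ^ ⌊(a i + 1)/2⌋ < p k for i ≥ 1 and 2 ^ a 0 < 8 (p k)², so every exponent is
-- O(log p k), and a i ≥ 3 forces p i ² < p k, so only O(√(p k)) indices contribute.
-- Chebyshev's argument with the central binomial coefficient (it is at least 2 ^ n,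
-- its prime factors are at most 2 n, and so are its prime-power divisors, by
-- Kummer's carry count) gives p k = O(k log k).  Hence the excess sum is
-- O(√k log² k), which is far below k^(2/3) / (log k)^(1/3).

open import Defs

open import Data.Nat
open import Data.Nat.Properties
open import Data.Nat.Divisibility
open import Data.Nat.DivMod
open import Data.Nat.Combinatorics
  using (_C_; nCk≡n!/k![n-k]!; k![n∸k]!∣n!; nCk≡nC[n∸k]; nCk+nC[k+1]≡[n+1]C[k+1])
open import Data.Nat.Tactic.RingSolver using (solve-∀)
open import Data.Nat.Primality
open import Data.Nat.Primality.Factorisation using (factorise)
open import Data.Nat.Induction using (<-wellFounded)
open import Data.Nat.Logarithm using (⌊log₂_⌋; ⌊log₂⌋-mono-≤; ⌊log₂⌊n/2⌋⌋≡⌊log₂n⌋∸1; ⌊log₂[2^n]⌋≡n)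
open import Induction.WellFounded using (Acc; acc)
open import Data.List using ([]; _∷_; length; applyUpTo)
open import Data.List.Properties using (length-applyUpTo; map-upTo)
open import Data.List.Membership.Propositional.Properties using (∈-applyUpTo⁺)
open import Data.List.Membership.Propositional using (_∈_)
open import Data.List.Relation.Unary.Any using (here; there)
open import Data.List.Relation.Unary.All using (All; []; _∷_)
open import Data.List.Relation.Unary.All.Properties using (applyUpTo⁺₂)
open import Data.Nat.ListAction using (sum; product)
open import Data.Bool using (true; false)
open import Function using (_∘_)
open import Data.Product using (∃; ∃₂; _×_; _,_; proj₁; proj₂)
open import Data.Sum using (inj₁; inj₂)
open import Relation.Nullary using (¬_; yes; no; contradiction)
open import Relation.Binary.PropositionalEquality

private variable
  i j m n p q : ℕ

prime⇒1<p : Prime p → 1 < p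
prime⇒1<p {p} pr = nonTrivial⇒n>1 p {{prime⇒nonTrivial pr}}

prime⇒∤1 : Prime p → ¬ p ∣ 1
prime⇒∤1 pr p∣1 = <⇒≢ (prime⇒1<p pr) (sym (∣1⇒≡1 p∣1))

prime∣n!⇒≤ : Prime p → p ∣ n ! → p ≤ n
prime∣n!⇒≤ {n = zero}  pr p∣1 = contradiction p∣1 (prime⇒∤1 pr)
prime∣n!⇒≤ {n = suc n} pr p∣n! with euclidsLemma (suc n) (n !) pr p∣n!
... | inj₁ p∣1+n = ∣⇒≤ p∣1+n
... | inj₂ p∣n!  = m≤n⇒m≤1+n (prime∣n!⇒≤ pr p∣n!)

module _ (p-prime : Prime p) where
  private instance
    p≢0 : NonZero p
    p≢0 = prime⇒nonZero p-prime

  p∤*p∤⇒p∤* : ¬ p ∣ m → ¬ p ∣ n → ¬ p ∣ m * n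
  p∤*p∤⇒p∤* {m} {n} p∤m p∤n p∣mn with euclidsLemma m n p-prime p∣mn
  ... | inj₁ p∣m = p∤m p∣m
  ... | inj₂ p∣n = p∤n p∣n

  p^e∣p^u*w⇒e≤u : ∀ e u {w} → ¬ p ∣ w → p ^ e ∣ p ^ u * w → e ≤ u
  p^e∣p^u*w⇒e≤u zero    u       p∤w _ = z≤n
  p^e∣p^u*w⇒e≤u (suc e) zero    p∤w d = contradiction (∣-trans (m*n∣⇒m∣ p (p ^ e) d) (∣-reflexive (+-identityʳ _))) p∤w
  p^e∣p^u*w⇒e≤u (suc e) (suc u) {w} p∤w d =
    s≤s (p^e∣p^u*w⇒e≤u e u p∤w (*-cancelˡ-∣ p (subst (p * p ^ e ∣_) (*-assoc p (p ^ u) w) d)))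

  factor-out : ∀ n .{{_ : NonZero n}} → ∃₂ λ e m → n ≡ p ^ e * m × ¬ p ∣ m
  factor-out n = go n (<-wellFounded n)
    where
    go : ∀ n .{{_ : NonZero n}} → Acc _<_ n → ∃₂ λ e m → n ≡ p ^ e * m × ¬ p ∣ m
    go n (acc rec) with p ∣? n
    ... | no p∤n = 0 , n , sym (*-identityˡ n) , p∤n
    ... | yes (divides-refl zero) = contradiction refl (≢-nonZero⁻¹ n)
    ... | yes (divides-refl q@(suc _)) with go q (rec (m<m*n q p (prime⇒1<p p-prime)))
    ...   | e , m , q≡p^e*m , p∤m =
      suc e , m , trans (cong (_* p) q≡p^e*m) (trans (*-comm _ p) (sym (*-assoc p (p ^ e) m))) , p∤m

∃prime∣ : 1 < n → ∃ λ q → Prime q × q ∣ n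
∃prime∣ {n} 1<n with factorise n {{>-nonZero (<-trans z<s 1<n)}}
... | record { factors = [] ; isFactorisation = n≡1 } = contradiction n≡1 (>⇒≢ 1<n)
... | record { factors = q ∷ qs ; isFactorisation = n≡q*qs ; factorsPrime = q-prime ∷ _ } =
  q , q-prime , divides (product qs) (trans n≡q*qs (*-comm q (product qs)))

smooth≤ : ∀ {b ps} → All Prime ps → ∀ n .{{_ : NonZero n}} →
          (∀ {q} → Prime q → q ∣ n → q ∈ ps) →
          (∀ {q} e → Prime q → q ^ e ∣ n → q ^ e ≤ b) →
          n ≤ b ^ length ps
smooth≤ [] 1 _ _ = ≤-refl
smooth≤ [] (2+ n) factors _ with ∃prime∣ {2+ n} (s<s z<s)
... | q , q-prime , q∣n with factors q-prime q∣n
... | ()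
smooth≤ {b} {p ∷ ps} (p-prime ∷ ps-prime) n factors powers with factor-out p-prime n
... | e , m , n≡p^e*m , p∤m = begin
  n                       ≡⟨ n≡p^e*m ⟩
  p ^ e * m               ≤⟨ *-mono-≤ (powers e p-prime (divides m (trans n≡p^e*m (*-comm _ m))))
                                      (smooth≤ ps-prime m {{m≢0}} factors′ powers′) ⟩
  b * b ^ length ps       ∎
  where
  open ≤-Reasoning
  m∣n : m ∣ n
  m∣n = divides (p ^ e) n≡p^e*m
  m≢0 : NonZero m
  m≢0 = ≢-nonZero λ { refl → ≢-nonZero⁻¹ n (trans n≡p^e*m (*-zeroʳ (p ^ e))) }
  factors′ : ∀ {q} → Prime q → q ∣ m → q ∈ ps
  factors′ q-prime q∣m with factors q-prime (∣-trans q∣m m∣n)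
  ... | here refl = contradiction q∣m p∤m
  ... | there q∈ps = q∈ps
  powers′ : ∀ {q} e → Prime q → q ^ e ∣ m → q ^ e ≤ b
  powers′ e q-prime d = powers e q-prime (∣-trans d m∣n)

[2n]∸n≡n : ∀ n → 2 * n ∸ n ≡ n
[2n]∸n≡n n = trans (m+n∸m≡n n (n + 0)) (+-identityʳ n)

centralBinomial : ℕ → ℕ
centralBinomial n = (2 * n) C n

[2n]!≡centralBinomial*[n!*n!] : ∀ n → (2 * n) ! ≡ centralBinomial n * (n ! * n !)
[2n]!≡centralBinomial*[n!*n!] n
  with nCk≡n!/k![n-k]! {2 * n} {n} (m≤m+n n (n + 0)) | k![n∸k]!∣n! {2 * n} {n} (m≤m+n n (n + 0))
... | C≡ | d rewrite [2n]∸n≡n n =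
  trans (sym (m/n*n≡m {{n !* n !≢0}} d)) (cong (_* (n ! * n !)) (sym C≡))

nCk≤[1+n]Ck : ∀ n k → n C k ≤ suc n C k
nCk≤[1+n]Ck n zero    = ≤-refl
nCk≤[1+n]Ck n (suc k) = ≤-trans (m≤n+m (n C suc k) (n C k)) (≤-reflexive (nCk+nC[k+1]≡[n+1]C[k+1] n k))

2*centralBinomial≤centralBinomial[1+n] : ∀ n → 2 * centralBinomial n ≤ centralBinomial (suc n)
2*centralBinomial≤centralBinomial[1+n] n = begin
  2 * centralBinomial n        ≤⟨ *-monoʳ-≤ 2 (nCk≤[1+n]Ck (2 * n) n) ⟩
  o C n + (o C n + 0)          ≡⟨ cong (λ x → o C n + x) (trans (+-identityʳ _) symmetry) ⟩
  o C n + o C suc n            ≡⟨ nCk+nC[k+1]≡[n+1]C[k+1] o n ⟩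
  suc o C suc n                ≡⟨ cong (_C suc n) (*-suc 2 n) ⟨
  centralBinomial (suc n)      ∎
  where
  open ≤-Reasoning
  o = suc (2 * n)
  symmetry : o C n ≡ o C suc n
  symmetry = sym (trans (nCk≡nC[n∸k] (s≤s (m≤m+n n (n + 0)))) (cong (o C_) ([2n]∸n≡n n)))

2^n≤centralBinomial : ∀ n → 2 ^ n ≤ centralBinomial n
2^n≤centralBinomial zero    = ≤-refl
2^n≤centralBinomial (suc n) = ≤-trans (*-monoʳ-≤ 2 (2^n≤centralBinomial n)) (2*centralBinomial≤centralBinomial[1+n] n)

2n+r≡[2q+c]*p+s′ : ∀ {n r q s c s′} → n ≡ q * p + s → 2 * s + r ≡ c * p + s′ →
                   2 * n + r ≡ (2 * q + c) * p + s′
2n+r≡[2q+c]*p+s′ {p} {n} {r} {q} {s} {c} {s′} refl 2s+r≡ = begin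
  2 * (q * p + s) + r       ≡⟨ lemma₁ q p s r ⟩
  2 * q * p + (2 * s + r)   ≡⟨ cong (2 * q * p +_) 2s+r≡ ⟩
  2 * q * p + (c * p + s′)  ≡⟨ lemma₂ q p c s′ ⟩
  (2 * q + c) * p + s′      ∎
  where
  open ≡-Reasoning
  lemma₁ : ∀ q p s r → 2 * (q * p + s) + r ≡ 2 * q * p + (2 * s + r)
  lemma₁ = solve-∀
  lemma₂ : ∀ q p c s′ → 2 * q * p + (c * p + s′) ≡ (2 * q + c) * p + s′
  lemma₂ = solve-∀

module _ (p-prime : Prime p) where
  private instance
    p≢0 : NonZero p
    p≢0 = prime⇒nonZero p-prime

  private
    p∤ : ¬ p ∣ m → ¬ p ∣ n → ¬ p ∣ m * n
    p∤ = p∤*p∤⇒p∤* p-prime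

  p∤t*p+s : ∀ t {s} → 0 < s → s < p → ¬ p ∣ t * p + s
  p∤t*p+s t {s} 0<s s<p p∣ = <⇒≱ s<p (∣⇒≤ {{>-nonZero 0<s}} (∣m+n∣m⇒∣n p∣ (n∣m*n t)))

  factorial-split : ∀ t {s} → s < p → ∃ λ R → ¬ p ∣ R × (t * p + s) ! ≡ p ^ t * (t ! * R)
  factorial-split zero    {zero}  _   = 1 , prime⇒∤1 p-prime , refl
  factorial-split (suc t) {zero}  _   with factorial-split t (≤-reflexive (suc-pred p))
  ... | R , p∤R , eq = R , p∤R , (begin
    (suc t * p + 0) !                   ≡⟨ cong _! last≡ ⟨
    suc x * x !                         ≡⟨ cong₂ _*_ last≡ eq ⟩
    (suc t * p + 0) * (p ^ t * (t ! * R)) ≡⟨ lemma t p (p ^ t) (t !) R ⟩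
    p ^ suc t * (suc t ! * R)           ∎)
    where
    open ≡-Reasoning
    x = t * p + pred p
    last≡ : suc x ≡ suc t * p + 0
    last≡ = begin
      suc (t * p + pred p) ≡⟨ +-suc (t * p) (pred p) ⟨
      t * p + suc (pred p) ≡⟨ cong (t * p +_) (suc-pred p) ⟩
      t * p + p            ≡⟨ +-comm (t * p) p ⟩
      p + t * p            ≡⟨ +-identityʳ _ ⟨
      suc t * p + 0        ∎
    lemma : ∀ t p P F R → (suc t * p + 0) * (P * (F * R)) ≡ p * P * ((F + t * F) * R)
    lemma = solve-∀
  factorial-split t       {suc s} s<p with factorial-split t {s} (<⇒≤ s<p)
  ... | R , p∤R , eq = x * R , p∤ (subst (λ y → ¬ p ∣ y) (+-suc (t * p) s) (p∤t*p+s t z<s s<p)) p∤R , (begin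
    (t * p + suc s) !             ≡⟨ cong _! (+-suc (t * p) s) ⟩
    x * (t * p + s) !             ≡⟨ cong (x *_) eq ⟩
    x * (p ^ t * (t ! * R))       ≡⟨ lemma x (p ^ t) (t !) R ⟩
    p ^ t * (t ! * (x * R))       ∎)
    where
    open ≡-Reasoning
    x = suc (t * p + s)
    lemma : ∀ x P F R → x * (P * (F * R)) ≡ P * (F * (x * R))
    lemma = solve-∀

  double-digit : ∀ s r → s < p → r ≤ 1 → ∃₂ λ c s′ → c ≤ 1 × s′ < p × 2 * s + r ≡ c * p + s′
  double-digit s r s<p r≤1 with 2 * s + r <? p
  ... | yes lt = 0 , 2 * s + r , z≤n , lt , refl
  ... | no ≮p = 1 , 2 * s + r ∸ p , ≤-refl , m<n+o⇒m∸n<o (2 * s + r) p 2s+r<p+p ,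
                  trans (sym (m+[n∸m]≡n (≮⇒≥ ≮p))) (cong (_+ (2 * s + r ∸ p)) (sym (*-identityˡ p)))
    where
    2s+r<p+p : 2 * s + r < p + p
    2s+r<p+p = begin-strict
      2 * s + r      ≤⟨ +-monoʳ-≤ (2 * s) r≤1 ⟩
      2 * s + 1      <⟨ ≤-trans (≤-reflexive (lemma s)) (+-mono-≤ s<p s<p) ⟩
      p + p          ∎
      where
      open ≤-Reasoning
      lemma : ∀ s → suc (2 * s + 1) ≡ suc s + suc s
      lemma = solve-∀

  -- p ^ u is the exact power of p in m ! / (n ! * n !), and it is at most 1 ⊔ m.
  BoundedValuation : ℕ → ℕ → Set
  BoundedValuation n m = ∃ λ u → p ^ u ≤ 1 ⊔ m ×
    ∃₂ λ v w → ¬ p ∣ v × ¬ p ∣ w × m ! * v ≡ n ! * n ! * (p ^ u * w)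

  p^[c+u]≤ : ∀ {c u} q s′ → c ≤ 1 → p ^ u ≤ 1 ⊔ (2 * q + c) → p ^ (c + u) ≤ 1 ⊔ ((2 * q + c) * p + s′)
  p^[c+u]≤ {zero}  q s′ _ p^u≤ =
    ≤-trans p^u≤ (⊔-monoʳ-≤ 1 (≤-trans (m≤m*n (2 * q + 0) p) (m≤m+n _ s′)))
  p^[c+u]≤ {suc zero} {u} q s′ _ p^u≤ = begin
    p * p ^ u             ≤⟨ *-monoʳ-≤ p (≤-trans p^u≤ (≤-reflexive (m≤n⇒m⊔n≡n (m≤n+m 1 (2 * q))))) ⟩
    p * (2 * q + 1)       ≡⟨ *-comm p _ ⟩
    (2 * q + 1) * p       ≤⟨ m≤m+n _ s′ ⟩
    (2 * q + 1) * p + s′  ≤⟨ m≤n⊔m 1 _ ⟩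
    1 ⊔ ((2 * q + 1) * p + s′) ∎
    where open ≤-Reasoning
  p^[c+u]≤ {2+ _} _ _ (s≤s ())

  -- Kummer's carry step: removing the multiples of p from (2 n + r) ! and n ! (factorial-split)
  -- reduces (2 n + r) ! / (n ! * n !) to (2 q + c) ! / (q ! * q !), times p ^ c.
  carry : ∀ {n r q s c s′} → n ≡ q * p + s → 2 * s + r ≡ c * p + s′ → s < p → s′ < p → c ≤ 1 →
          BoundedValuation q (2 * q + c) → BoundedValuation n (2 * n + r)
  carry {n} {r} {q} {s} {c} {s′} n≡ 2s+r≡ s<p s′<p c≤1 (u , p^u≤ , v , w , p∤v , p∤w , eq)
    with factorial-split (2 * q + c) s′<p | factorial-split q s<p
  ... | R₁ , p∤R₁ , eq₁ | R₂ , p∤R₂ , eq₂ =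
    c + u , subst (λ m → p ^ (c + u) ≤ 1 ⊔ m) (sym m≡) (p^[c+u]≤ q s′ c≤1 p^u≤) ,
    v * (R₂ * R₂) , R₁ * w , p∤ p∤v (p∤ p∤R₂ p∤R₂) , p∤ p∤R₁ p∤w , (begin
      (2 * n + r) ! * (v * (R₂ * R₂))                       ≡⟨ cong (λ m → m ! * (v * (R₂ * R₂))) m≡ ⟩
      ((2 * q + c) * p + s′) ! * (v * (R₂ * R₂))            ≡⟨ cong (_* (v * (R₂ * R₂))) eq₁ ⟩
      p ^ (2 * q + c) * (G * R₁) * (v * (R₂ * R₂))          ≡⟨ cong (λ x → x * (G * R₁) * (v * (R₂ * R₂))) p^[2q+c] ⟩
      X * X * Y * (G * R₁) * (v * (R₂ * R₂))                ≡⟨ regroup₁ X Y G R₁ v R₂ ⟩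
      X * X * Y * R₁ * (R₂ * R₂) * (G * v)                  ≡⟨ cong (X * X * Y * R₁ * (R₂ * R₂) *_) eq ⟩
      X * X * Y * R₁ * (R₂ * R₂) * (F * F * (p ^ u * w))    ≡⟨ regroup₂ X Y R₁ R₂ F (p ^ u) w ⟩
      X * (F * R₂) * (X * (F * R₂)) * (Y * p ^ u * (R₁ * w)) ≡⟨ cong₂ (λ a b → a * a * (b * (R₁ * w))) (sym n!≡) (sym (^-distribˡ-+-* p c u)) ⟩
      n ! * n ! * (p ^ (c + u) * (R₁ * w))                  ∎)
    where
    open ≡-Reasoning
    X = p ^ q
    Y = p ^ c
    F = q !
    G = (2 * q + c) !
    m≡ : 2 * n + r ≡ (2 * q + c) * p + s′
    m≡ = 2n+r≡[2q+c]*p+s′ {p = p} {q = q} {c = c} n≡ 2s+r≡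
    p^[2q+c] : p ^ (2 * q + c) ≡ X * X * Y
    p^[2q+c] = trans (^-distribˡ-+-* p (2 * q) c)
                     (cong (_* Y) (trans (cong (p ^_) (cong (q +_) (+-identityʳ q))) (^-distribˡ-+-* p q q)))
    n!≡ : n ! ≡ X * (F * R₂)
    n!≡ = trans (cong _! n≡) eq₂
    regroup₁ : ∀ X Y G R₁ v R₂ → X * X * Y * (G * R₁) * (v * (R₂ * R₂)) ≡ X * X * Y * R₁ * (R₂ * R₂) * (G * v)
    regroup₁ = solve-∀
    regroup₂ : ∀ X Y R₁ R₂ F P w → X * X * Y * R₁ * (R₂ * R₂) * (F * F * (P * w)) ≡ X * (F * R₂) * (X * (F * R₂)) * (Y * P * (R₁ * w))
    regroup₂ = solve-∀

  boundedValuation : ∀ n {r} → r ≤ 1 → BoundedValuation n (2 * n + r)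
  boundedValuation n = go n (<-wellFounded n)
    where
    go : ∀ n → Acc _<_ n → ∀ {r} → r ≤ 1 → BoundedValuation n (2 * n + r)
    go zero    _         z≤n       = 0 , m≤m⊔n 1 0 , 1 , 1 , prime⇒∤1 p-prime , prime⇒∤1 p-prime , refl
    go zero    _         (s≤s z≤n) = 0 , m≤m⊔n 1 1 , 1 , 1 , prime⇒∤1 p-prime , prime⇒∤1 p-prime , refl
    go n@(suc _) (acc rec) {r} r≤1 with double-digit (n % p) r (m%n<n n p) r≤1
    ... | c , s′ , c≤1 , s′<p , 2s+r≡ =
      carry {q = n / p} n≡ 2s+r≡ (m%n<n n p) s′<p c≤1 (go (n / p) (rec (m/n<m n p (prime⇒1<p p-prime))) c≤1)
      where
      n≡ : n ≡ n / p * p + n % p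
      n≡ = trans (m≡m%n+[m/n]*n n p) (+-comm (n % p) _)

  p^e∣centralBinomial⇒p^e≤1⊔2n : ∀ n e → p ^ e ∣ centralBinomial n → p ^ e ≤ 1 ⊔ 2 * n
  p^e∣centralBinomial⇒p^e≤1⊔2n n e p^e∣C with boundedValuation n {0} z≤n
  ... | u , p^u≤ , v , w , _ , p∤w , eq = ≤-trans (^-monoʳ-≤ p e≤u) (subst (λ m → p ^ u ≤ 1 ⊔ m) (+-identityʳ (2 * n)) p^u≤)
    where
    instance _ = n !* n !≢0
    C*v≡ : centralBinomial n * v ≡ p ^ u * w
    C*v≡ = *-cancelˡ-≡ _ _ (n ! * n !) (begin
      n ! * n ! * (centralBinomial n * v)   ≡⟨ lemma (n ! * n !) (centralBinomial n) v ⟩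
      centralBinomial n * (n ! * n !) * v ≡⟨ cong (_* v) (trans (cong _! (+-identityʳ (2 * n))) ([2n]!≡centralBinomial*[n!*n!] n)) ⟨
      (2 * n + 0) ! * v     ≡⟨ eq ⟩
      n ! * n ! * (p ^ u * w) ∎)
      where
      open ≡-Reasoning
      lemma : ∀ F B v → F * (B * v) ≡ B * F * v
      lemma = solve-∀
    e≤u : e ≤ u
    e≤u = p^e∣p^u*w⇒e≤u p-prime e u p∤w (subst (p ^ e ∣_) C*v≡ (∣-trans p^e∣C (m∣m*n v)))

m^i<m^j⇒i<j : ∀ m .{{_ : NonZero m}} i j → m ^ i < m ^ j → i < j
m^i<m^j⇒i<j m i j m^i<m^j = ≰⇒> (λ j≤i → <⇒≱ m^i<m^j (^-monoʳ-≤ m j≤i))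

n≤[n+1]/2*2 : ∀ n → n ≤ (n + 1) / 2 * 2
n≤[n+1]/2*2 n = s≤s⁻¹ (begin
  suc n                              ≡⟨ +-comm 1 n ⟩
  n + 1                              ≡⟨ m≡m%n+[m/n]*n (n + 1) 2 ⟩
  (n + 1) % 2 + (n + 1) / 2 * 2      ≤⟨ +-monoˡ-≤ _ (s≤s⁻¹ (m%n<n (n + 1) 2)) ⟩
  suc ((n + 1) / 2 * 2)              ∎)
  where open ≤-Reasoning

sum-applyUpTo≤ : ∀ {f : ℕ → ℕ} {b} R k → (∀ i → f i ≤ b) → (∀ i → R ≤ i → f i ≡ 0) →
                 sum (applyUpTo f k) ≤ R * b
sum-applyUpTo≤ R       zero    _    _    = z≤n
sum-applyUpTo≤ {f} zero (suc k) f≤b f≡0 =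
  +-mono-≤ (≤-reflexive (f≡0 0 z≤n)) (sum-applyUpTo≤ {f ∘ suc} zero k (f≤b ∘ suc) (λ i _ → f≡0 (suc i) z≤n))
sum-applyUpTo≤ {f} (suc R) (suc k) f≤b f≡0 =
  +-mono-≤ (f≤b 0) (sum-applyUpTo≤ {f ∘ suc} R k (f≤b ∘ suc) (λ i R≤i → f≡0 (suc i) (s≤s R≤i)))

excess≤ : ∀ n → excess n ≤ n
excess≤ n with 3 ≤ᵇ n
... | true  = m∸n≤m n 2
... | false = z≤n

excess≡0 : ∀ {n} → n < 3 → excess n ≡ 0
excess≡0 {0} _ = refl
excess≡0 {1} _ = refl
excess≡0 {2} _ = refl
excess≡0 {suc (suc (suc _))} (s≤s (s≤s (s≤s ())))

n<2^n : ∀ n → n < 2 ^ n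
n<2^n zero    = z<s
n<2^n (suc n) = begin-strict
  suc n               ≡⟨ +-comm 1 n ⟩
  n + 1               <⟨ +-mono-<-≤ (n<2^n n) (m^n>0 2 n) ⟩
  2 ^ n + 2 ^ n       ≡⟨ cong (2 ^ n +_) (+-identityʳ (2 ^ n)) ⟨
  2 ^ suc n           ∎
  where open ≤-Reasoning

2^[3+u]≡8*2^u : ∀ u → 2 ^ (3 + u) ≡ 8 * 2 ^ u
2^[3+u]≡8*2^u u = lemma (2 ^ u)
  where
  lemma : ∀ E → 2 * (2 * (2 * E)) ≡ 8 * E
  lemma = solve-∀

3+u<8*2^u : ∀ u → 3 + u < 8 * 2 ^ u
3+u<8*2^u u = subst (3 + u <_) (2^[3+u]≡8*2^u u) (n<2^n (3 + u))

32*4^u*[3+u]≤256*8^u : ∀ u → 32 * (2 ^ u * 2 ^ u) * (3 + u) ≤ 256 * (2 ^ u) ^ 3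
32*4^u*[3+u]≤256*8^u u = begin
  32 * (E * E) * (3 + u)   ≤⟨ *-monoʳ-≤ (32 * (E * E)) (<⇒≤ (3+u<8*2^u u)) ⟩
  32 * (E * E) * (8 * E)   ≡⟨ lemma E ⟩
  256 * E ^ 3              ∎
  where
  open ≤-Reasoning
  E = 2 ^ u
  lemma : ∀ E → 32 * (E * E) * (8 * E) ≡ 256 * (E * (E * (E * 1)))
  lemma = solve-∀

[m*n]^k≡m^k*n^k : ∀ m n k → (m * n) ^ k ≡ m ^ k * n ^ k
[m*n]^k≡m^k*n^k m n zero    = refl
[m*n]^k≡m^k*n^k m n (suc k) = trans (cong (m * n *_) ([m*n]^k≡m^k*n^k m n k)) (lemma m n (m ^ k) (n ^ k))
  where
  lemma : ∀ m n x y → m * n * (x * y) ≡ m * x * (n * y)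
  lemma = solve-∀

n^d≤d^d*2^n : ∀ d .{{_ : NonZero d}} n → n ^ d ≤ d ^ d * 2 ^ n
n^d≤d^d*2^n d n = begin
  n ^ d                  ≤⟨ ^-monoˡ-≤ d (<⇒≤ (<-≤-trans n<d*[1+k] (*-monoʳ-≤ d (n<2^n k)))) ⟩
  (d * 2 ^ k) ^ d        ≡⟨ [m*n]^k≡m^k*n^k d (2 ^ k) d ⟩
  d ^ d * (2 ^ k) ^ d    ≡⟨ cong (d ^ d *_) (^-*-assoc 2 k d) ⟩
  d ^ d * 2 ^ (k * d)    ≤⟨ *-monoʳ-≤ (d ^ d) (^-monoʳ-≤ 2 (m/n*n≤m n d)) ⟩
  d ^ d * 2 ^ n          ∎
  where
  open ≤-Reasoning
  k = n / d
  n<d*[1+k] : n < d * suc k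
  n<d*[1+k] = begin-strict
    n                     ≡⟨ m≡m%n+[m/n]*n n d ⟩
    n % d + k * d         <⟨ +-monoˡ-< (k * d) (m%n<n n d) ⟩
    d + k * d             ≡⟨ cong (d +_) (*-comm k d) ⟩
    d + d * k             ≡⟨ *-suc d k ⟨
    d * suc k             ∎

⌊n/2⌋+⌊n/2⌋≤n : ∀ n → ⌊ n /2⌋ + ⌊ n /2⌋ ≤ n
⌊n/2⌋+⌊n/2⌋≤n n = ≤-trans (+-monoʳ-≤ ⌊ n /2⌋ (⌊n/2⌋≤⌈n/2⌉ n)) (≤-reflexive (⌊n/2⌋+⌈n/2⌉≡n n))

n≤1+⌊n/2⌋+⌊n/2⌋ : ∀ n → n ≤ suc (⌊ n /2⌋ + ⌊ n /2⌋)
n≤1+⌊n/2⌋+⌊n/2⌋ n = begin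
  n                        ≡⟨ ⌊n/2⌋+⌈n/2⌉≡n n ⟨
  ⌊ n /2⌋ + ⌈ n /2⌉        ≤⟨ +-monoʳ-≤ ⌊ n /2⌋ (⌊n/2⌋-mono (n≤1+n (suc n))) ⟩
  ⌊ n /2⌋ + suc ⌊ n /2⌋    ≡⟨ +-suc ⌊ n /2⌋ ⌊ n /2⌋ ⟩
  suc (⌊ n /2⌋ + ⌊ n /2⌋)  ∎
  where open ≤-Reasoning

2^⌊log₂n⌋≤n : ∀ n .{{_ : NonZero n}} → 2 ^ ⌊log₂ n ⌋ ≤ n
2^⌊log₂n⌋≤n n = go n (<-wellFounded n)
  where
  go : ∀ n .{{_ : NonZero n}} → Acc _<_ n → 2 ^ ⌊log₂ n ⌋ ≤ n
  go 1          _         = ≤-refl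
  -- ⌊log₂ n ⌋ is a successor for n ≥ 2, so the ∸ 1 below computes away.
  go n@(2+ m) (acc rec) = begin
    2 ^ ⌊log₂ n ⌋              ≡⟨ cong (λ e → 2 * 2 ^ e) (⌊log₂⌊n/2⌋⌋≡⌊log₂n⌋∸1 n) ⟨
    2 * 2 ^ ⌊log₂ ⌊ n /2⌋ ⌋    ≤⟨ *-monoʳ-≤ 2 (go ⌊ n /2⌋ (rec (⌊n/2⌋<n (suc m)))) ⟩
    2 * ⌊ n /2⌋                ≡⟨ cong (⌊ n /2⌋ +_) (+-identityʳ ⌊ n /2⌋) ⟩
    ⌊ n /2⌋ + ⌊ n /2⌋          ≤⟨ ⌊n/2⌋+⌊n/2⌋≤n n ⟩
    n                          ∎
    where open ≤-Reasoning

n<2^[1+⌊log₂n⌋] : ∀ n → n < 2 ^ suc ⌊log₂ n ⌋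
n<2^[1+⌊log₂n⌋] n = ≰⇒> λ 2^[1+ℓ]≤n →
  1+n≰n (subst (_≤ ⌊log₂ n ⌋) (⌊log₂[2^n]⌋≡n (suc ⌊log₂ n ⌋)) (⌊log₂⌋-mono-≤ 2^[1+ℓ]≤n))

⌊log₂⌋-window : ∀ k .{{_ : NonZero k}} →
                ∃ λ u → 2 ^ u * 2 ^ u ≤ k × k ≤ 4 * (2 ^ u * 2 ^ u) × ⌊log₂ k ⌋ ≤ 2 * u + 1
⌊log₂⌋-window k = u , lower , upper , ≤-trans (n≤1+⌊n/2⌋+⌊n/2⌋ ℓ) (≤-reflexive (lemma u))
  where
  ℓ = ⌊log₂ k ⌋
  u = ⌊ ℓ /2⌋
  lemma : ∀ u → suc (u + u) ≡ 2 * u + 1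
  lemma = solve-∀
  lower : 2 ^ u * 2 ^ u ≤ k
  lower = begin
    2 ^ u * 2 ^ u   ≡⟨ ^-distribˡ-+-* 2 u u ⟨
    2 ^ (u + u)     ≤⟨ ^-monoʳ-≤ 2 (⌊n/2⌋+⌊n/2⌋≤n ℓ) ⟩
    2 ^ ℓ           ≤⟨ 2^⌊log₂n⌋≤n k ⟩
    k               ∎
    where open ≤-Reasoning
  upper : k ≤ 4 * (2 ^ u * 2 ^ u)
  upper = begin
    k                      ≤⟨ <⇒≤ (n<2^[1+⌊log₂n⌋] k) ⟩
    2 ^ suc ℓ              ≤⟨ ^-monoʳ-≤ 2 (s≤s (n≤1+⌊n/2⌋+⌊n/2⌋ ℓ)) ⟩
    2 ^ (2 + (u + u))      ≡⟨ ^-distribˡ-+-* 2 2 (u + u) ⟩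
    4 * 2 ^ (u + u)        ≡⟨ cong (4 *_) (^-distribˡ-+-* 2 u u) ⟩
    4 * (2 ^ u * 2 ^ u)    ∎
    where open ≤-Reasoning

module _ {p : ℕ → ℕ} (enum : PrimeEnumeration p) where
  open PrimeEnumeration enum

  p-mono-< : i < j → p i < p j
  p-mono-< {j = suc j} i<1+j with m≤n⇒m<n∨m≡n (s≤s⁻¹ i<1+j)
  ... | inj₁ i<j  = <-trans (p-mono-< i<j) (increasing j)
  ... | inj₂ refl = increasing j

  p-mono-≤ : i ≤ j → p i ≤ p j
  p-mono-≤ i≤j with m≤n⇒m<n∨m≡n i≤j
  ... | inj₁ i<j  = <⇒≤ (p-mono-< i<j)
  ... | inj₂ refl = ≤-refl

  2+i≤p[i] : ∀ i → 2 + i ≤ p i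
  2+i≤p[i] zero    = prime⇒1<p (isPrime 0)
  2+i≤p[i] (suc i) = ≤-trans (s≤s (2+i≤p[i] i)) (increasing i)

  prime<p[j]⇒∈ : Prime q → q < p j → q ∈ applyUpTo p j
  prime<p[j]⇒∈ {j = j} q-prime q<p[j] with onto _ q-prime
  ... | i , refl = ∈-applyUpTo⁺ p (≰⇒> (λ j≤i → <⇒≱ q<p[j] (p-mono-≤ j≤i)))

  2^n≤[2n]^j : 1 ≤ n → 2 * n < p j → 2 ^ n ≤ (2 * n) ^ j
  2^n≤[2n]^j {n} {j} 1≤n 2n<p[j] = begin
    2 ^ n                                  ≤⟨ 2^n≤centralBinomial n ⟩
    centralBinomial n                      ≤⟨ smooth≤ (applyUpTo⁺₂ p j isPrime) (centralBinomial n) {{C≢0}} factors powers ⟩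
    (2 * n) ^ length (applyUpTo p j)       ≡⟨ cong ((2 * n) ^_) (length-applyUpTo p j) ⟩
    (2 * n) ^ j                            ∎
    where
    open ≤-Reasoning
    C≢0 : NonZero (centralBinomial n)
    C≢0 = >-nonZero (≤-trans (m^n>0 2 n) (2^n≤centralBinomial n))
    factors : Prime q → q ∣ centralBinomial n → q ∈ applyUpTo p j
    factors q-prime q∣C = prime<p[j]⇒∈ q-prime (≤-<-trans (prime∣n!⇒≤ q-prime (∣-trans q∣C C∣[2n]!)) 2n<p[j])
      where
      C∣[2n]! : centralBinomial n ∣ (2 * n) !
      C∣[2n]! = divides (n ! * n !) (trans ([2n]!≡centralBinomial*[n!*n!] n) (*-comm _ (n ! * n !)))
    powers : ∀ e → Prime q → q ^ e ∣ centralBinomial n → q ^ e ≤ 2 * n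
    powers e q-prime d = ≤-trans (p^e∣centralBinomial⇒p^e≤1⊔2n q-prime n e d)
                                 (≤-reflexive (m≤n⇒m⊔n≡n (≤-trans 1≤n (m≤m+n n (n + 0)))))

  p[k]≤2*[M*T] : ∀ {k} M T .{{_ : NonZero M}} .{{_ : NonZero T}} →
                 k ≤ M → 2 * (M * T) < 2 ^ T → p k ≤ 2 * (M * T)
  p[k]≤2*[M*T] {k} M T k≤M 2MT<2^T with p k ≤? 2 * (M * T)
  ... | yes p[k]≤ = p[k]≤
  ... | no  p[k]≰ = contradiction 2^[M*T]<2^[M*T] (<-irrefl refl)
    where
    instance _ = m*n≢0 2 (M * T) {{_}} {{m*n≢0 M T}}
    open ≤-Reasoning
    2^[M*T]<2^[M*T] : 2 ^ (M * T) < 2 ^ (M * T)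
    2^[M*T]<2^[M*T] = begin-strict
      2 ^ (M * T)          ≤⟨ 2^n≤[2n]^j (>-nonZero⁻¹ (M * T) {{m*n≢0 M T}}) (≰⇒> p[k]≰) ⟩
      (2 * (M * T)) ^ k    ≤⟨ ^-monoʳ-≤ (2 * (M * T)) k≤M ⟩
      (2 * (M * T)) ^ M    <⟨ ^-monoˡ-< M 2MT<2^T ⟩
      (2 ^ T) ^ M          ≡⟨ ^-*-assoc 2 T M ⟩
      2 ^ (T * M)          ≡⟨ cong (2 ^_) (*-comm T M) ⟩
      2 ^ (M * T)          ∎

  -- Chebyshev with M = 4 ^ (u + 1) ≥ k and T = 4 (u + 3), for which 2 M T < 2 ^ T.
  p[k]≤32*4^u*[3+u] : ∀ {k} u → k ≤ 4 * (2 ^ u * 2 ^ u) → p k ≤ 32 * (2 ^ u * 2 ^ u) * (3 + u)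
  p[k]≤32*4^u*[3+u] {k} u k≤M = subst (p k ≤_) (2MT≡ E w) (p[k]≤2*[M*T] M T k≤M 2MT<2^T)
    where
    open ≤-Reasoning
    E = 2 ^ u
    w = 3 + u
    M = 4 * (E * E)
    T = 4 * w
    instance
      E*E≢0 : NonZero (E * E)
      E*E≢0 = m*n≢0 E E {{m^n≢0 2 u}} {{m^n≢0 2 u}}
      M≢0 : NonZero M
      M≢0 = m*n≢0 4 (E * E)
    2MT≡ : ∀ E w → 2 * (4 * (E * E) * (4 * w)) ≡ 32 * (E * E) * w
    2MT≡ = solve-∀
    2MT<2^T : 2 * (M * T) < 2 ^ T
    2MT<2^T = begin-strict
      2 * (M * T)              ≡⟨ 2MT≡ E w ⟩
      32 * (E * E) * w         <⟨ *-monoʳ-< (32 * (E * E)) {{m*n≢0 32 (E * E)}} (3+u<8*2^u u) ⟩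
      32 * (E * E) * (8 * E)   ≡⟨ lemma₁ E ⟩
      256 * E ^ 3 * 1          ≤⟨ *-monoʳ-≤ (256 * E ^ 3) (≤-trans (m^n>0 2 u) (m≤n*m E 16)) ⟩
      256 * E ^ 3 * (16 * E)   ≡⟨ lemma₂ E ⟩
      (8 * E) ^ 4              ≡⟨ cong (_^ 4) (2^[3+u]≡8*2^u u) ⟨
      (2 ^ w) ^ 4              ≡⟨ ^-*-assoc 2 w 4 ⟩
      2 ^ (w * 4)              ≡⟨ cong (2 ^_) (*-comm w 4) ⟩
      2 ^ T                    ∎
      where
      lemma₁ : ∀ E → 32 * (E * E) * (8 * E) ≡ 256 * (E * (E * (E * 1))) * 1
      lemma₁ = solve-∀
      lemma₂ : ∀ E → 256 * (E * (E * (E * 1))) * (16 * E) ≡ 8 * E * (8 * E * (8 * E * (8 * E * 1)))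
      lemma₂ = solve-∀

module _ {p : ℕ → ℕ} (enum : PrimeEnumeration p) {a : ℕ → ℕ} (reduced : Reduced p a)
         {k : ℕ} (k≢0 : k ≢ 0) (a[k]≡0 : a k ≡ 0) where
  open PrimeEnumeration enum

  private
    p[i]^⌊[a[i]+1]/2⌋<p[k] : ∀ i → p (suc i) ^ ((a (suc i) + 1) / 2) < p k
    p[i]^⌊[a[i]+1]/2⌋<p[k] i =
      subst (λ x → p (suc i) ^ ((a (suc i) + 1) / (2 + x)) < p k) a[k]≡0 (proj₁ reduced (suc i) k (λ ()) k≢0)
    2≤p[i] : ∀ i → 2 ≤ p i
    2≤p[i] i = ≤-trans (m≤m+n 2 i) (2+i≤p[i] enum i)

  a[i]≤2L+2 : ∀ {L} → p k ≤ 2 ^ L → ∀ i → a i ≤ 2 * L + 2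
  a[i]≤2L+2 {L} p[k]≤2^L zero = s≤s⁻¹ (≤-trans (m^i<m^j⇒i<j 2 (a 0) (3 + L * 2) 2^a₀<) (≤-reflexive (lemma L)))
    where
    lemma : ∀ L → 3 + L * 2 ≡ suc (2 * L + 2)
    lemma = solve-∀
    2^a₀< : 2 ^ a 0 < 2 ^ (3 + L * 2)
    2^a₀< = begin-strict
      2 ^ a 0             <⟨ proj₂ reduced k a[k]≡0 ⟩
      8 * p k ^ 2         ≤⟨ *-monoʳ-≤ 8 (^-monoˡ-≤ 2 p[k]≤2^L) ⟩
      8 * (2 ^ L) ^ 2     ≡⟨ cong (8 *_) (^-*-assoc 2 L 2) ⟩
      8 * 2 ^ (L * 2)     ≡⟨ ^-distribˡ-+-* 2 3 (L * 2) ⟨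
      2 ^ (3 + L * 2)     ∎
      where open ≤-Reasoning
  a[i]≤2L+2 {L} p[k]≤2^L (suc i) = begin
    a (suc i)        ≤⟨ n≤[n+1]/2*2 (a (suc i)) ⟩
    s * 2            ≤⟨ *-monoˡ-≤ 2 (<⇒≤ s<L) ⟩
    L * 2            ≤⟨ ≤-reflexive (*-comm L 2) ⟩
    2 * L            ≤⟨ m≤m+n (2 * L) 2 ⟩
    2 * L + 2        ∎
    where
    open ≤-Reasoning
    s = (a (suc i) + 1) / 2
    s<L : s < L
    s<L = m^i<m^j⇒i<j 2 s L (≤-<-trans (^-monoˡ-≤ s (2≤p[i] (suc i))) (<-≤-trans (p[i]^⌊[a[i]+1]/2⌋<p[k] i) p[k]≤2^L))

  a[i]<3 : ∀ {R} → p k ≤ R * R → ∀ {i} → R ≤ i → a i < 3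
  a[i]<3 {R} p[k]≤R*R {i} R≤i with a i <? 3
  ... | yes a[i]<3 = a[i]<3
  a[i]<3 {zero} p[k]≤R*R {zero} R≤i | no _ = contradiction p[k]≤R*R (<⇒≱ (<-trans z<s (prime⇒1<p (isPrime k))))
  a[i]<3 {suc R} p[k]≤R*R {zero} () | no _
  a[i]<3 {R} p[k]≤R*R {suc i} R≤i | no a[i]≮3 = contradiction R≤i (<⇒≱ (begin-strict
      suc i             <⟨ n<1+n (suc i) ⟩
      2 + i             ≤⟨ m≤n+m (2 + i) 1 ⟩
      3 + i             ≤⟨ 2+i≤p[i] enum (suc i) ⟩
      P                 <⟨ P<R ⟩
      R                 ∎))
    where
    open ≤-Reasoning
    P = p (suc i)
    s = (a (suc i) + 1) / 2
    2≤s : 2 ≤ s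
    2≤s = ≰⇒> (λ s≤1 → a[i]≮3 (s≤s (≤-trans (n≤[n+1]/2*2 (a (suc i))) (*-monoˡ-≤ 2 s≤1))))
    P*P<R*R : P * P < R * R
    P*P<R*R = begin-strict
      P * P        ≡⟨ cong (P *_) (*-identityʳ P) ⟨
      P ^ 2        ≤⟨ ^-monoʳ-≤ P {{>-nonZero (<-trans z<s (2≤p[i] (suc i)))}} 2≤s ⟩
      P ^ s        <⟨ p[i]^⌊[a[i]+1]/2⌋<p[k] i ⟩
      p k          ≤⟨ p[k]≤R*R ⟩
      R * R        ∎
    P<R : P < R
    P<R = ≰⇒> (λ R≤P → <⇒≱ P*P<R*R (*-mono-≤ R≤P R≤P))

  excessSum≤ : ∀ u → p k ≤ 32 * (2 ^ u * 2 ^ u) * (3 + u) → excessSum a k ≤ 48 * 2 ^ u * ((3 + u) * (3 + u))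
  excessSum≤ u p[k]≤ = begin
    excessSum a k                           ≡⟨ cong sum (map-upTo (λ i → excess (a i)) k) ⟩
    sum (applyUpTo (λ i → excess (a i)) k)  ≤⟨ sum-applyUpTo≤ R k excess[a[i]]≤2L+2 excess[a[i]]≡0 ⟩
    R * (2 * L + 2)                         ≡⟨ lemma E u ⟩
    48 * E * (w * w)                        ∎
    where
    open ≤-Reasoning
    E = 2 ^ u
    w = 3 + u
    L = 3 * u + 8
    R = 8 * E * w
    lemma : ∀ E u → 8 * E * (3 + u) * (2 * (3 * u + 8) + 2) ≡ 48 * E * ((3 + u) * (3 + u))
    lemma = solve-∀
    p[k]≤2^L : p k ≤ 2 ^ L
    p[k]≤2^L = begin
      p k                      ≤⟨ p[k]≤ ⟩
      32 * (E * E) * w         ≤⟨ 32*4^u*[3+u]≤256*8^u u ⟩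
      256 * E ^ 3              ≡⟨ *-comm 256 (E ^ 3) ⟩
      E ^ 3 * 2 ^ 8            ≡⟨ cong (_* 2 ^ 8) (^-*-assoc 2 u 3) ⟩
      2 ^ (u * 3) * 2 ^ 8      ≡⟨ ^-distribˡ-+-* 2 (u * 3) 8 ⟨
      2 ^ (u * 3 + 8)          ≡⟨ cong (λ e → 2 ^ (e + 8)) (*-comm u 3) ⟩
      2 ^ L                    ∎
    p[k]≤R*R : p k ≤ R * R
    p[k]≤R*R = begin
      p k                        ≤⟨ p[k]≤ ⟩
      32 * (E * E) * w           ≡⟨ *-identityʳ _ ⟨
      32 * (E * E) * w * 1       ≤⟨ *-monoʳ-≤ (32 * (E * E) * w) (s≤s z≤n) ⟩
      32 * (E * E) * w * (2 * w) ≡⟨ lemma′ E w ⟩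
      R * R                      ∎
      where
      lemma′ : ∀ E w → 32 * (E * E) * w * (2 * w) ≡ 8 * E * w * (8 * E * w)
      lemma′ = solve-∀
    excess[a[i]]≤2L+2 : ∀ i → excess (a i) ≤ 2 * L + 2
    excess[a[i]]≤2L+2 i = ≤-trans (excess≤ (a i)) (a[i]≤2L+2 {L} p[k]≤2^L i)
    excess[a[i]]≡0 : ∀ i → R ≤ i → excess (a i) ≡ 0
    excess[a[i]]≡0 i R≤i = excess≡0 (a[i]<3 p[k]≤R*R R≤i)

S^3*ℓ≤16*c^3*d*k^2 : ∀ {S ℓ k} c d u → S ≤ c * 2 ^ u * ((3 + u) * (3 + u)) → ℓ ≤ 2 * u + 1 →
                  (3 + u) ^ 7 ≤ d * 2 ^ (3 + u) → 2 ^ u * 2 ^ u ≤ k →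
                  S ^ 3 * ℓ ≤ 16 * (c * c * c) * d * k ^ 2
S^3*ℓ≤16*c^3*d*k^2 {S} {ℓ} {k} c d u S≤ ℓ≤ w^7≤ E*E≤k = begin
  S ^ 3 * ℓ                                  ≤⟨ *-mono-≤ (^-monoˡ-≤ 3 S≤) (≤-trans ℓ≤ (2u+1≤2w u)) ⟩
  (c * E * (w * w)) ^ 3 * (2 * w)            ≡⟨ expand c E w ⟩
  2 * (c * c * c) * (E * E * E) * w ^ 7      ≤⟨ *-monoʳ-≤ (2 * (c * c * c) * (E * E * E)) w^7≤ ⟩
  2 * (c * c * c) * (E * E * E) * (d * 2 ^ (3 + u)) ≡⟨ collect (c * c * c) d E ⟩
  16 * (c * c * c) * d * (E * E) ^ 2         ≤⟨ *-monoʳ-≤ (16 * (c * c * c) * d) (^-monoˡ-≤ 2 E*E≤k) ⟩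
  16 * (c * c * c) * d * k ^ 2               ∎
  where
  open ≤-Reasoning
  E = 2 ^ u
  w = 3 + u
  2u+1≤2w : ∀ u → 2 * u + 1 ≤ 2 * (3 + u)
  2u+1≤2w u = ≤-trans (+-monoʳ-≤ (2 * u) (s≤s (z≤n {5}))) (≤-reflexive (lemma u))
    where
    lemma : ∀ u → 2 * u + 6 ≡ 2 * (3 + u)
    lemma = solve-∀
  expand : ∀ c E w → c * E * (w * w) * (c * E * (w * w) * (c * E * (w * w) * 1)) * (2 * w)
                   ≡ 2 * (c * c * c) * (E * E * E) * (w * (w * (w * (w * (w * (w * (w * 1)))))))
  expand = solve-∀
  collect : ∀ a b E → 2 * a * (E * E * E) * (b * (2 * (2 * (2 * E)))) ≡ 16 * a * b * ((E * E) * ((E * E) * 1))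
  collect = solve-∀

lemma3p14 : (p : ℕ → ℕ) → PrimeEnumeration p →
    ∃₂ λ (C K : ℕ) → ∀ (a : ℕ → ℕ) (k : ℕ) → k ≥ K →
      Reduced p a →
      (∀ i → i ≥ k → a i ≡ 0) →
      (∀ m → k ≡ suc m → 1 ≤ a m) →
      excessSum a k ^ 3 * ⌊log₂ k ⌋ ≤ C * k ^ 2
lemma3p14 p enum = 16 * (48 * 48 * 48) * 7 ^ 7 , 1 , λ a k 1≤k reduced vanish _ →
  let (u , 4^u≤k , k≤4^[1+u] , ⌊log₂k⌋≤2u+1) = ⌊log₂⌋-window k {{>-nonZero 1≤k}} in
  S^3*ℓ≤16*c^3*d*k^2 48 (7 ^ 7) u
    (excessSum≤ enum reduced (>⇒≢ 1≤k) (vanish k ≤-refl) u (p[k]≤32*4^u*[3+u] enum u k≤4^[1+u]))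
    ⌊log₂k⌋≤2u+1 (n^d≤d^d*2^n 7 (3 + u)) 4^u≤k
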